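{- For any set $S \subseteq V$ and any subset $T \subseteq S$ of conflicting nodes, the inequality $\sum_{a \in \delta^+(S) \cap \grave{A}^{+}_{T}} y_a \geq \sum_{i\in T} z_i$ is valid for $\mathcal{P}$.
   Context: Let $G=(V,A)$ be a DAG with $V=\{1,\dots,n\}$ and $\check{A}\subseteq A$. Let $\bar{G}=(\bar V,\bar A)$ with $\bar V=\{0\}\cup V\cup\{\bar n\}$, $\bar n=n+1$, and $\bar A=\{(0,i):i\in V\}\cup A\cup\{(i,\bar n):i\in V\}$. For $S\subseteq\bar V$, $\delta^+(S)$ (resp. $\delta^-(S)$) denotes the arcs of $\bar A$ leaving (resp. entering) $S$. A path $(0,v_1,\dots,v_h,\bar n)$ in $\bar G$ is feasible if it traverses at least one arc of $\check{A}$, and infeasible otherwise. $\mathcal{P}$ is the convex hull of all binary vectors $y\in\{0,1\}^{|\bar A|}$ satisfying $\sum_{a\in\delta^-(i)}y_a\le 1$ and $\sum_{a\in\delta^-(i)}y_a=\sum_{a\in\delta^+(i)}y_a$ for all $i\in V$, and $\sum_{i=0}^h y_{(v_i,v_{i+1})}\le h$ for every infeasible path $(v_0=0,v_1,\dots,v_h,v_{h+1}=\bar n)$. For $i\in V$, $z_i=\sum_{a\in\delta^-(i)}y_a$. Two nodes are conflicting if no path in $\bar G$ passes through both; a set of conflicting nodes is a set of pairwise conflicting nodes. For each $i\in V$, $\grave{A}^{+}_{i}$ is the set of arcs of all partial paths of the form $(i,\ldots,\bar n)$ that are part of a feasible path from $0$ to $\bar n$; $\grave{A}^{+}_{T}=\bigcup_{i\in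 T}\grave{A}^{+}_{i}$.
   Formalization: Validity for $\mathcal{P}$ is required only at points that are rational convex combinations of the admissible binary vectors, so these points have rational coordinates. -}

module Defs where

open import Data.Nat using (ℕ; zero; suc; _∸_)
open import Data.Bool using (Bool; true; false; T; _∧_; not; if_then_else_)
open import Data.Bool.Properties using (T?)
open import Data.Fin using (Fin; _≟_)
open import Data.Fin.Base using ()
open import Data.List using (List; []; _∷_; _++_; map; foldr; filter; concatMap; length; allFin)
open import Data.List.Membership.Propositional using (_∈_)
open import Data.List.Relation.Unary.Any using (Any)
open import Data.List.Relation.Unary.All using (All)
open import Data.Product using (Σ; ∃; ∃-syntax; _×_; _,_; proj₁; proj₂)
open import Data.Integer using (+_)
open import Data.Rational using (ℚ; 0ℚ; 1ℚ; _+_; _*_; _≤_; _/_)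
open import Relation.Nullary using (¬_; yes; no; does)
open import Relation.Binary.PropositionalEquality using (_≡_; _≢_)
open import Function.Bundles using (_⇔_)

-- Nodes of the extended graph Ḡ: 0 (source), i ∈ V = Fin n, n̄ (sink)
data Node (n : ℕ) : Set where
  source : Node n
  inn    : Fin n → Node n
  sink   : Node n

Rel : ℕ → Set
Rel n = Fin n → Fin n → Bool

ArcB : {n : ℕ} → Rel n → Node n → Node n → Bool
ArcB A source (inn i) = true
ArcB A (inn i) (inn j) = A i j
ArcB A (inn i) sink = true
ArcB A _ _ = false

Arc : {n : ℕ} → Rel n → Set
Arc {n} A = Σ (Node n × Node n) (λ p → T (ArcB A (proj₁ p) (proj₂ p)))

tl hd : {n : ℕ} {A : Rel n} → Arc A → Node n
tl a = proj₁ (proj₁ a)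
hd a = proj₂ (proj₁ a)

InCheck : {n : ℕ} {A : Rel n} → Rel n → Arc A → Bool
InCheck Ǎ ((inn i , inn j) , _) = Ǎ i j
InCheck Ǎ _ = false

data Walk {n : ℕ} (A : Rel n) : Node n → Node n → Set where
  []  : {u : Node n} → Walk A u u
  _∷_ : {u v w : Node n} → T (ArcB A u v) → Walk A v w → Walk A u w

_++W_ : {n : ℕ} {A : Rel n} {u v w : Node n} → Walk A u v → Walk A v w → Walk A u w
[] ++W q = q
(e ∷ p) ++W q = e ∷ (p ++W q)

arcsW : {n : ℕ} {A : Rel n} {u w : Node n} → Walk A u w → List (Arc A)
arcsW [] = []
arcsW {u = u} (_∷_ {v = v} e p) = ((u , v) , e) ∷ arcsW p

nodesW : {n : ℕ} {A : Rel n} {u w : Node n} → Walk A u w → List (Node n)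
nodesW {u = u} [] = u ∷ []
nodesW {u = u} (e ∷ p) = u ∷ nodesW p

Acyclic : {n : ℕ} → Rel n → Set
Acyclic {n} A = (i : Fin n) (p : Walk A (inn i) (inn i)) → arcsW p ≡ []

Feasible : {n : ℕ} {A : Rel n} → Rel n → Walk A source sink → Set
Feasible Ǎ p = Any (λ a → T (InCheck Ǎ a)) (arcsW p)

Conflicting : {n : ℕ} → Rel n → Fin n → Fin n → Set
Conflicting {n} A i j =
  ¬ (Σ (Node n) λ u → Σ (Node n) λ w → Σ (Walk A u w) λ p →
       (inn i ∈ nodesW p) × (inn j ∈ nodesW p))

Subset : ℕ → Set
Subset n = Fin n → Bool

_⊆_ : {n : ℕ} → Subset n → Subset n → Set
T₁ ⊆ S = ∀ i → T (T₁ i) → T (S i)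

ConflictingSet : {n : ℕ} → Rel n → Subset n → Set
ConflictingSet A Tset = ∀ i j → T (Tset i) → T (Tset j) → i ≢ j → Conflicting A i j

InAgrave : {n : ℕ} (A Ǎ : Rel n) → Fin n → Arc A → Set
InAgrave A Ǎ i a =
  Σ (Walk A source (inn i)) λ p₁ → Σ (Walk A (inn i) sink) λ p₂ →
    Feasible Ǎ (p₁ ++W p₂) × (a ∈ arcsW p₂)

InAgraveT : {n : ℕ} (A Ǎ : Rel n) → Subset n → Arc A → Set
InAgraveT A Ǎ Tset a = ∃[ i ] (T (Tset i) × InAgrave A Ǎ i a)

allNodes : (n : ℕ) → List (Node n)
allNodes n = source ∷ (map inn (allFin n) ++ (sink ∷ []))

arcsFrom : {n : ℕ} (A : Rel n) → Node n → Node n → List (Arc A)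
arcsFrom A u v with T? (ArcB A u v)
... | yes e = ((u , v) , e) ∷ []
... | no _ = []

allArcs : {n : ℕ} (A : Rel n) → List (Arc A)
allArcs {n} A = concatMap (λ u → concatMap (λ v → arcsFrom A u v) (allNodes n)) (allNodes n)

_==N_ : {n : ℕ} → Node n → Node n → Bool
source ==N source = true
inn i ==N inn j = does (i ≟ j)
sink ==N sink = true
_ ==N _ = false

inS : {n : ℕ} → Subset n → Node n → Bool
inS S (inn i) = S i
inS S _ = false

sumQ : List ℚ → ℚ
sumQ = foldr _+_ 0ℚ

sumArcs : {n : ℕ} (A : Rel n) → (Arc A → Bool) → (Arc A → ℚ) → ℚ
sumArcs A P y = sumQ (map y (Data.List.filter (λ a → T? (P a)) (allArcs A)))

inArc : {n : ℕ} {A : Rel n} → Node n → Arc A → Bool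
inArc v a = hd a ==N v

outArc : {n : ℕ} {A : Rel n} → Node n → Arc A → Bool
outArc v a = tl a ==N v

outOfSet : {n : ℕ} {A : Rel n} → Subset n → Arc A → Bool
outOfSet S a = inS S (tl a) ∧ not (inS S (hd a))

zval : {n : ℕ} (A : Rel n) → (Arc A → ℚ) → Fin n → ℚ
zval A y i = sumArcs A (inArc (inn i)) y

sumV : {n : ℕ} → Subset n → (Fin n → ℚ) → ℚ
sumV {n} Tset f = sumQ (map f (Data.List.filter (λ i → T? (Tset i)) (allFin n)))

ℕtoℚ : ℕ → ℚ
ℕtoℚ h = (+ h) / 1

b2q : Bool → ℚ
b2q true = 1ℚ
b2q false = 0ℚ

Admissible : {n : ℕ} (A Ǎ : Rel n) → (Arc A → Bool) → Set
Admissible {n} A Ǎ x =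
  ((i : Fin n) → sumArcs A (inArc (inn i)) y ≤ 1ℚ)
  × ((i : Fin n) → sumArcs A (inArc (inn i)) y ≡ sumArcs A (outArc (inn i)) y)
  × ((p : Walk A source sink) → ¬ Feasible Ǎ p →
       sumQ (map y (arcsW p)) ≤ ℕtoℚ (length (arcsW p) ∸ 1))
  where
  y : Arc A → ℚ
  y a = b2q (x a)

-- 𝒫 = conv of admissible binary vectors (rational convex combinations)
InP : {n : ℕ} (A Ǎ : Rel n) → (Arc A → ℚ) → Set
InP A Ǎ y =
  Σ (List (ℚ × (Arc A → Bool))) λ cs →
    All (λ c → (0ℚ ≤ proj₁ c) × Admissible A Ǎ (proj₂ c)) cs
    × (sumQ (map proj₁ cs) ≡ 1ℚ)
    × (∀ a → y a ≡ sumQ (map (λ c → proj₁ c * b2q (proj₂ c a)) cs))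

{-# OPTIONS --safe #-}
module Submission where

-- By linearity it suffices to prove the inequality at an admissible binary
-- point x.  The support of x is a set of node-disjoint source–sink paths: the
-- in-degrees are at most 1, flow is conserved, and acyclicity makes following
-- support arcs forwards or backwards terminate.  Each of these paths is
-- feasible, since a path all of whose arcs are used violates its
-- infeasible-path inequality.  Hence every i ∈ T with z_i = 1 lies on a
-- feasible path, whose part after i belongs to À⁺_i; as i ∈ S, that part
-- leaves S through an arc of δ⁺(S) ∩ À⁺_T used by x.  Distinct i, j ∈ T
-- cannot leave through the same arc: tracing the unique support arcs back from
-- it would put i and j on one path, but they conflict.  So the number of such
-- i, which is Σ_{i∈T} z_i, is at most the number of used arcs in δ⁺(S) ∩ À⁺_T.

open import Defs
open import Data.Nat using (ℕ)
open import Data.Bool using (Bool; T; _∧_)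
open import Data.Rational using (ℚ; _≥_)
open import Function.Bundles using (_⇔_)

open import Algebra.Bundles using (CommutativeMonoid)
open import Data.Bool using (true; false; not)
open import Data.Bool.Properties using (T?; T-irrelevant; T-∧)
open import Data.Empty using (⊥-elim)
open import Data.Fin as Fin using (Fin)
open import Data.Integer as ℤ using (+_; +≤+)
import Data.Integer.Properties as ℤP
open import Data.List using (List; []; _∷_; _++_; map; filter; length; concatMap; allFin)
open import Data.List.Membership.Propositional using (_∈_)
open import Data.List.Membership.Propositional.Properties
  using (∈-map⁺; ∈-++⁺ˡ; ∈-++⁺ʳ; ∈-allFin; ∈-concatMap⁺; ∈-filter⁺; ∈-filter⁻)
open import Data.List.Properties using (length-removeAt′; filter-all; map-cong)
open import Data.List.Relation.Unary.All as All using (All; []; _∷_)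
open import Data.List.Relation.Unary.All.Properties using () renaming (++⁺ to All-++⁺)
open import Data.List.Relation.Unary.AllPairs using ([]; _∷_)
open import Data.List.Relation.Unary.Any as Any using (here; there; _─_; any?)
open import Data.List.Relation.Unary.Unique.Propositional using (Unique)
open import Data.List.Relation.Unary.Unique.Propositional.Properties using (filter⁺; allFin⁺)
open import Data.Nat using (zero; suc; _+_; _∸_; _≤_; _<_; _≤?_; z≤n; s≤s)
open import Data.Nat.Coprimality using (1-coprimeTo) renaming (sym to coprime-sym)
open import Data.Nat.ListAction using (sum)
import Data.Nat.Properties as ℕP
open import Data.Product using (_,_; proj₁; proj₂; _×_; ∃-syntax; Σ-syntax)
open import Data.Rational as ℚ using (mkℚ; *≤*; 0ℚ; 1ℚ)
import Data.Rational.Properties as ℚP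
open import Data.Rational.Unnormalised using (*≡*)
import Data.Rational.Unnormalised.Properties as ℚᵘP
open import Data.Sum using (_⊎_; inj₁; inj₂)
open import Data.Unit using (tt)
open import Function.Bundles using (Equivalence)
open import Relation.Binary.PropositionalEquality
open import Relation.Nullary using (¬_; yes; no; contradiction)

open import Algebra.Properties.CommutativeSemigroup (CommutativeMonoid.commutativeSemigroup ℚP.+-0-commutativeMonoid)
  using () renaming (interchange to +-interchange)

ℕ/1 : ℕ → ℚ
ℕ/1 h = mkℚ (+ h) 0 (coprime-sym (1-coprimeTo h))

ℕtoℚ≡ℕ/1 : ∀ h → ℕtoℚ h ≡ ℕ/1 h
ℕtoℚ≡ℕ/1 h = ℚP.normalize-coprime _

ℕtoℚ-+ : ∀ a b → ℕtoℚ (a + b) ≡ ℕtoℚ a ℚ.+ ℕtoℚ b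
ℕtoℚ-+ a b rewrite ℕtoℚ≡ℕ/1 (a + b) | ℕtoℚ≡ℕ/1 a | ℕtoℚ≡ℕ/1 b =
  ℚP.toℚᵘ-injective (ℚᵘP.≃-trans (*≡* numerators) (ℚᵘP.≃-sym (ℚP.toℚᵘ-homo-+ (ℕ/1 a) (ℕ/1 b))))
  where
  numerators : + (a + b) ℤ.* + 1 ≡ (+ a ℤ.* + 1 ℤ.+ + b ℤ.* + 1) ℤ.* + 1
  numerators = cong (ℤ._* + 1)
    (trans (ℤP.pos-+ a b) (sym (cong₂ ℤ._+_ (ℤP.*-identityʳ (+ a)) (ℤP.*-identityʳ (+ b)))))

ℕtoℚ-mono-≤ : ∀ {a b} → a ≤ b → ℕtoℚ a ℚ.≤ ℕtoℚ b
ℕtoℚ-mono-≤ {a} {b} a≤b rewrite ℕtoℚ≡ℕ/1 a | ℕtoℚ≡ℕ/1 b =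
  *≤* (subst₂ ℤ._≤_ (sym (ℤP.*-identityʳ (+ a))) (sym (ℤP.*-identityʳ (+ b))) (+≤+ a≤b))

ℕtoℚ-cancel-≤ : ∀ {a b} → ℕtoℚ a ℚ.≤ ℕtoℚ b → a ≤ b
ℕtoℚ-cancel-≤ {a} {b} le rewrite ℕtoℚ≡ℕ/1 a | ℕtoℚ≡ℕ/1 b with le
... | *≤* p = ℤP.drop‿+≤+ (subst₂ ℤ._≤_ (ℤP.*-identityʳ (+ a)) (ℤP.*-identityʳ (+ b)) p)

ℕtoℚ-injective : ∀ {a b} → ℕtoℚ a ≡ ℕtoℚ b → a ≡ b
ℕtoℚ-injective eq =
  ℕP.≤-antisym (ℕtoℚ-cancel-≤ (ℚP.≤-reflexive eq)) (ℕtoℚ-cancel-≤ (ℚP.≤-reflexive (sym eq)))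

module _ {X : Set} where

  sumQ-map-+ : (g h : X → ℚ) (xs : List X) →
    sumQ (map (λ x → g x ℚ.+ h x) xs) ≡ sumQ (map g xs) ℚ.+ sumQ (map h xs)
  sumQ-map-+ g h [] = refl
  sumQ-map-+ g h (x ∷ xs) rewrite sumQ-map-+ g h xs = +-interchange (g x) (h x) _ _

  sumQ-map-*ˡ : (r : ℚ) (g : X → ℚ) (xs : List X) → sumQ (map (λ x → r ℚ.* g x) xs) ≡ r ℚ.* sumQ (map g xs)
  sumQ-map-*ˡ r g [] = sym (ℚP.*-zeroʳ r)
  sumQ-map-*ˡ r g (x ∷ xs) rewrite sumQ-map-*ˡ r g xs = sym (ℚP.*-distribˡ-+ r (g x) _)

  sumQ-map-0 : (xs : List X) → sumQ (map (λ _ → 0ℚ) xs) ≡ 0ℚ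
  sumQ-map-0 [] = refl
  sumQ-map-0 (x ∷ xs) rewrite sumQ-map-0 xs = refl

  sumQ-map-mono : {g h : X → ℚ} (xs : List X) → All (λ x → g x ℚ.≤ h x) xs →
                  sumQ (map g xs) ℚ.≤ sumQ (map h xs)
  sumQ-map-mono [] [] = ℚP.≤-refl
  sumQ-map-mono (x ∷ xs) (g≤h ∷ gs≤hs) = ℚP.+-mono-≤ g≤h (sumQ-map-mono xs gs≤hs)

sumQ-map-comm : {X Y : Set} (f : X → Y → ℚ) (xs : List X) (ys : List Y) →
  sumQ (map (λ y → sumQ (map (λ x → f x y) xs)) ys) ≡ sumQ (map (λ x → sumQ (map (f x) ys)) xs)
sumQ-map-comm f xs [] = sym (sumQ-map-0 xs)
sumQ-map-comm f xs (y ∷ ys) rewrite sumQ-map-comm f xs ys =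
  sym (sumQ-map-+ (λ x → f x y) (λ x → sumQ (map (f x) ys)) xs)

combine : {X : Set} → List (ℚ × X) → (X → ℚ) → ℚ
combine cs g = sumQ (map (λ c → proj₁ c ℚ.* g (proj₂ c)) cs)

sumQ-map-combine : {X Y : Set} (cs : List (ℚ × X)) (f : X → Y → ℚ) (ys : List Y) →
  sumQ (map (λ y → combine cs (λ x → f x y)) ys) ≡ combine cs (λ x → sumQ (map (f x) ys))
sumQ-map-combine cs f ys = trans (sumQ-map-comm (λ c y → proj₁ c ℚ.* f (proj₂ c) y) cs ys)
  (cong sumQ (map-cong (λ c → sumQ-map-*ˡ (proj₁ c) (f (proj₂ c)) ys) cs))

combine-mono : {X : Set} {Q : X → Set} {g h : X → ℚ} (cs : List (ℚ × X)) →
  All (λ c → 0ℚ ℚ.≤ proj₁ c × Q (proj₂ c)) cs → (∀ x → Q x → g x ℚ.≤ h x) →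
  combine cs g ℚ.≤ combine cs h
combine-mono cs weighted g≤h =
  sumQ-map-mono cs (All.map (λ { {w , x} (0≤w , qx) → ℚP.*-monoˡ-≤-nonNeg w {{ℚ.nonNegative 0≤w}} (g≤h x qx) }) weighted)

module _ {X : Set} where

  ∈-─ : {x y : X} {ys : List X} (x∈ys : x ∈ ys) → y ∈ ys → y ≢ x → y ∈ (ys ─ x∈ys)
  ∈-─ (here refl) (here refl) y≢x = ⊥-elim (y≢x refl)
  ∈-─ (here refl) (there y∈ys) _ = y∈ys
  ∈-─ (there _) (here refl) _ = here refl
  ∈-─ (there x∈ys) (there y∈ys) y≢x = there (∈-─ x∈ys y∈ys y≢x)

  ∈⇒1≤length : {x : X} {xs : List X} → x ∈ xs → 1 ≤ length xs
  ∈⇒1≤length {xs = _ ∷ _} _ = s≤s z≤n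

  1≤length⇒∈ : {xs : List X} → 1 ≤ length xs → ∃[ x ] x ∈ xs
  1≤length⇒∈ {x ∷ _} _ = x , here refl

injection⇒length≤ : {X Y : Set} (R : X → Y → Set) {xs : List X} {ys : List Y} → Unique xs →
  (∀ {x} → x ∈ xs → ∃[ y ] (y ∈ ys × R x y)) → (∀ {x x′ y} → R x y → R x′ y → x ≡ x′) →
  length xs ≤ length ys
injection⇒length≤ R {[]} _ _ _ = z≤n
injection⇒length≤ R {x ∷ xs} {ys} (x∉xs ∷ xs-unique) image injective with image (here refl)
... | y , y∈ys , xRy = begin
  suc (length xs)          ≤⟨ s≤s (injection⇒length≤ R xs-unique image′ injective) ⟩
  suc (length (ys ─ y∈ys)) ≡⟨ length-removeAt′ ys (Any.index y∈ys) ⟨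
  length ys                ∎
  where
  open ℕP.≤-Reasoning
  image′ : ∀ {x′} → x′ ∈ xs → ∃[ y′ ] (y′ ∈ (ys ─ y∈ys) × R x′ y′)
  image′ x′∈xs with image (there x′∈xs)
  ... | y′ , y′∈ys , x′Ry′ =
    y′ , ∈-─ y∈ys y′∈ys (λ { refl → All.lookup x∉xs x′∈xs (injective xRy x′Ry′) }) , x′Ry′

unique-⊆⇒length≤ : {X : Set} {xs ys : List X} → Unique xs → (∀ {x} → x ∈ xs → x ∈ ys) →
                   length xs ≤ length ys
unique-⊆⇒length≤ xs-unique xs⊆ys =
  injection⇒length≤ _≡_ xs-unique (λ x∈xs → _ , xs⊆ys x∈xs , refl) (λ x≡y x′≡y → trans x≡y (sym x′≡y))

sum≤length-filter : {X : Set} (c : X → ℕ) → (∀ x → c x ≤ 1) → (xs : List X) →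
  sum (map c xs) ≤ length (filter (λ x → 1 ≤? c x) xs)
sum≤length-filter c c≤1 [] = z≤n
sum≤length-filter c c≤1 (x ∷ xs) with c x | c≤1 x
... | zero | _ = sum≤length-filter c c≤1 xs
... | suc zero | _ = s≤s (sum≤length-filter c c≤1 xs)
... | suc (suc _) | s≤s ()

module _ {X : Set} (f : X → Bool) where

  count : List X → ℕ
  count xs = length (filter (λ x → T? (f x)) xs)

  sumQ-b2q≡count : (xs : List X) → sumQ (map (λ x → b2q (f x)) xs) ≡ ℕtoℚ (count xs)
  sumQ-b2q≡count [] = refl
  sumQ-b2q≡count (x ∷ xs) with f x
  ... | true = trans (cong (1ℚ ℚ.+_) (sumQ-b2q≡count xs)) (sym (ℕtoℚ-+ 1 (count xs)))
  ... | false = trans (ℚP.+-identityˡ _) (sumQ-b2q≡count xs)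

  count-all : {xs : List X} → All (λ x → T (f x)) xs → count xs ≡ length xs
  count-all all = cong length (filter-all (λ x → T? (f x)) all)

sumQ-map-ℕtoℚ : {X : Set} (c : X → ℕ) (xs : List X) →
                sumQ (map (λ x → ℕtoℚ (c x)) xs) ≡ ℕtoℚ (sum (map c xs))
sumQ-map-ℕtoℚ c [] = refl
sumQ-map-ℕtoℚ c (x ∷ xs) = trans (cong (ℕtoℚ (c x) ℚ.+_) (sumQ-map-ℕtoℚ c xs)) (sym (ℕtoℚ-+ (c x) _))

module _ {n : ℕ} where

  ==N⇒≡ : (u v : Node n) → T (u ==N v) → u ≡ v
  ==N⇒≡ source source _ = refl
  ==N⇒≡ (inn i) (inn j) i==j with i Fin.≟ j
  ... | yes refl = refl
  ==N⇒≡ sink sink _ = refl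

  ==N-refl : (u : Node n) → T (u ==N u)
  ==N-refl source = tt
  ==N-refl (inn i) with i Fin.≟ i
  ... | yes _ = tt
  ... | no i≢i = i≢i refl
  ==N-refl sink = tt

  allNodes-complete : (u : Node n) → u ∈ allNodes n
  allNodes-complete source = here refl
  allNodes-complete (inn i) = there (∈-++⁺ˡ (∈-map⁺ inn (∈-allFin i)))
  allNodes-complete sink = there (∈-++⁺ʳ (map inn (allFin n)) (here refl))

module Graph {n : ℕ} (A : Rel n) where

  allArcs-complete : (a : Arc A) → a ∈ allArcs A
  allArcs-complete ((u , v) , e) =
    ∈-concatMap⁺ (λ u → concatMap (arcsFrom A u) (allNodes n))
      (Any.map (λ { refl → ∈-concatMap⁺ (arcsFrom A u) (Any.map (λ { refl → ∈-arcsFrom }) (allNodes-complete v)) })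
               (allNodes-complete u))
    where
    ∈-arcsFrom : ((u , v) , e) ∈ arcsFrom A u v
    ∈-arcsFrom with T? (ArcB A u v)
    ... | yes e′ = here (cong (λ e″ → (u , v) , e″) (T-irrelevant e e′))
    ... | no ¬e = ⊥-elim (¬e e)

  arcsInto arcsOutOf : Fin n → List (Arc A)
  arcsInto v = filter (λ a → T? (inArc (inn v) a)) (allArcs A)
  arcsOutOf v = filter (λ a → T? (outArc (inn v) a)) (allArcs A)

  ∈-arcsInto⁺ : ∀ {u v} (e : T (ArcB A u (inn v))) → ((u , inn v) , e) ∈ arcsInto v
  ∈-arcsInto⁺ {v = v} e = ∈-filter⁺ (λ a → T? (inArc (inn v) a)) (allArcs-complete _) (==N-refl (inn v))

  ∈-arcsInto⁻ : ∀ {a v} → a ∈ arcsInto v → hd a ≡ inn v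
  ∈-arcsInto⁻ {a} {v} a∈ =
    ==N⇒≡ (hd a) (inn v) (proj₂ (∈-filter⁻ (λ a → T? (inArc (inn v) a)) {xs = allArcs A} a∈))

  ∈-arcsOutOf⁺ : ∀ {v w} (e : T (ArcB A (inn v) w)) → ((inn v , w) , e) ∈ arcsOutOf v
  ∈-arcsOutOf⁺ {v} e = ∈-filter⁺ (λ a → T? (outArc (inn v) a)) (allArcs-complete _) (==N-refl (inn v))

  ∈-arcsOutOf⁻ : ∀ {a v} → a ∈ arcsOutOf v → tl a ≡ inn v
  ∈-arcsOutOf⁻ {a} {v} a∈ =
    ==N⇒≡ (tl a) (inn v) (proj₂ (∈-filter⁻ (λ a → T? (outArc (inn v) a)) {xs = allArcs A} a∈))

  arcsW-++ : ∀ {u v w} (p : Walk A u v) (q : Walk A v w) → arcsW (p ++W q) ≡ arcsW p ++ arcsW q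
  arcsW-++ [] q = refl
  arcsW-++ (e ∷ p) q = cong (_ ∷_) (arcsW-++ p q)

  length-arcsW-▻ : ∀ {u v w} (p : Walk A u v) (e : T (ArcB A v w)) →
                   length (arcsW (p ++W (e ∷ []))) ≡ suc (length (arcsW p))
  length-arcsW-▻ [] e = refl
  length-arcsW-▻ (e′ ∷ p) e = cong suc (length-arcsW-▻ p e)

  ∈-nodesW-start : ∀ {u w} (p : Walk A u w) → u ∈ nodesW p
  ∈-nodesW-start [] = here refl
  ∈-nodesW-start (e ∷ p) = here refl

  ∈-nodesW-end : ∀ {u w} (p : Walk A u w) → w ∈ nodesW p
  ∈-nodesW-end [] = here refl
  ∈-nodesW-end (e ∷ p) = there (∈-nodesW-end p)

  prefix : ∀ {u v w} (p : Walk A u w) → v ∈ nodesW p → Walk A u v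
  prefix [] (here refl) = []
  prefix (e ∷ p) (here refl) = []
  prefix (e ∷ p) (there v∈p) = e ∷ prefix p v∈p

  no-arc-into-source : ∀ u → ¬ T (ArcB A u source)
  no-arc-into-source source ()
  no-arc-into-source (inn _) ()
  no-arc-into-source sink ()

  walk-into-source : ∀ {u} → Walk A u source → u ≡ source
  walk-into-source [] = refl
  walk-into-source (_∷_ {u} e p) with refl ← walk-into-source p = ⊥-elim (no-arc-into-source u e)

  module _ (acyclic : Acyclic A) where

    no-return : ∀ {u v} → T (ArcB A u v) → ¬ Walk A v u
    no-return {inn i} e p with () ← acyclic i (e ∷ p)
    no-return {source} e p with refl ← walk-into-source p = no-arc-into-source source e
    no-return {sink} ()

    nodesW-unique : ∀ {u w} (p : Walk A u w) → Unique (nodesW p)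
    nodesW-unique [] = [] ∷ []
    nodesW-unique (e ∷ p) = All.tabulate (λ v∈p → λ { refl → no-return e (prefix p v∈p) }) ∷ nodesW-unique p

    length-arcsW< : ∀ {u w} (p : Walk A u w) → length (arcsW p) < length (allNodes n)
    length-arcsW< p = subst (_≤ length (allNodes n)) (length-nodesW p)
      (unique-⊆⇒length≤ (nodesW-unique p) (λ {v} _ → allNodes-complete v))
      where
      length-nodesW : ∀ {u w} (p : Walk A u w) → length (nodesW p) ≡ suc (length (arcsW p))
      length-nodesW [] = refl
      length-nodesW (e ∷ p) = cong suc (length-nodesW p)

module Support {n : ℕ} (A : Rel n) (x : Arc A → Bool) where
  open Graph A

  XArc : Node n → Node n → Set
  XArc u v = Σ[ e ∈ T (ArcB A u v) ] T (x ((u , v) , e))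

  XWalk : Node n → Node n → Set
  XWalk u w = Σ[ p ∈ Walk A u w ] All (λ a → T (x a)) (arcsW p)

  []ˣ : ∀ {u} → XWalk u u
  []ˣ = [] , []

  _◅_ : ∀ {u v w} → XArc u v → XWalk v w → XWalk u w
  (e , xe) ◅ (p , xp) = e ∷ p , xe ∷ xp

  _++ˣ_ : ∀ {u v w} → XWalk u v → XWalk v w → XWalk u w
  (p , xp) ++ˣ (q , xq) = p ++W q , subst (All (λ a → T (x a))) (sym (arcsW-++ p q)) (All-++⁺ xp xq)

  unsnoc : ∀ {u w} → XWalk u w → u ≡ w ⊎ ∃[ s ] (XWalk u s × XArc s w)
  unsnoc ([] , []) = inj₁ refl
  unsnoc (e ∷ p , xe ∷ xp) with unsnoc (p , xp)
  ... | inj₁ refl = inj₂ (_ , []ˣ , (e , xe))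
  ... | inj₂ (s , q , a) = inj₂ (s , (e , xe) ◅ q , a)

  sumArcs≡count : ∀ P → sumArcs A P (λ a → b2q (x a)) ≡
                        ℕtoℚ (count x (filter (λ a → T? (P a)) (allArcs A)))
  sumArcs≡count P = sumQ-b2q≡count x (filter (λ a → T? (P a)) (allArcs A))

  inDeg outDeg : Fin n → ℕ
  inDeg v = count x (arcsInto v)
  outDeg v = count x (arcsOutOf v)

  XArc∈x-arcsInto : ∀ {u v} ((e , _) : XArc u (inn v)) → ((u , inn v) , e) ∈ filter (λ a → T? (x a)) (arcsInto v)
  XArc∈x-arcsInto (e , xe) = ∈-filter⁺ (λ a → T? (x a)) (∈-arcsInto⁺ e) xe

  XArc⇒1≤inDeg : ∀ {u v} → XArc u (inn v) → 1 ≤ inDeg v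
  XArc⇒1≤inDeg a = ∈⇒1≤length (XArc∈x-arcsInto a)

  XArc⇒1≤outDeg : ∀ {v w} → XArc (inn v) w → 1 ≤ outDeg v
  XArc⇒1≤outDeg (e , xe) = ∈⇒1≤length (∈-filter⁺ (λ a → T? (x a)) (∈-arcsOutOf⁺ e) xe)

  1≤inDeg⇒XArc : ∀ {v} → 1 ≤ inDeg v → ∃[ u ] XArc u (inn v)
  1≤inDeg⇒XArc {v} 1≤deg with 1≤length⇒∈ {xs = filter (λ a → T? (x a)) (arcsInto v)} 1≤deg
  ... | ((u , _) , e) , a∈ with ∈-filter⁻ (λ a → T? (x a)) {xs = arcsInto v} a∈
  ...   | a∈into , xa with refl ← ∈-arcsInto⁻ a∈into = u , e , xa

  1≤outDeg⇒XArc : ∀ {v} → 1 ≤ outDeg v → ∃[ w ] XArc (inn v) w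
  1≤outDeg⇒XArc {v} 1≤deg with 1≤length⇒∈ {xs = filter (λ a → T? (x a)) (arcsOutOf v)} 1≤deg
  ... | ((_ , w) , e) , a∈ with ∈-filter⁻ (λ a → T? (x a)) {xs = arcsOutOf v} a∈
  ...   | a∈outOf , xa with refl ← ∈-arcsOutOf⁻ a∈outOf = w , e , xa

  inDeg≤1⇒XArc-unique : ∀ {u u′ v} → inDeg v ≤ 1 → XArc u (inn v) → XArc u′ (inn v) → u ≡ u′
  inDeg≤1⇒XArc-unique {u} {u′} {v} deg≤1 a@(e , _) a′@(e′ , _) with T? (u ==N u′)
  ... | yes u==u′ = ==N⇒≡ u u′ u==u′
  ... | no u≠u′ = contradiction (ℕP.≤-trans two≤deg deg≤1) λ { (s≤s ()) }
    where
    a≢a′ : ((u , inn v) , e) ≢ ((u′ , inn v) , e′)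
    a≢a′ eq = u≠u′ (subst (λ b → T (u ==N tl b)) eq (==N-refl u))
    two≤deg : 2 ≤ inDeg v
    two≤deg = unique-⊆⇒length≤ ((a≢a′ ∷ []) ∷ [] ∷ [])
      λ { (here refl) → XArc∈x-arcsInto a ; (there (here refl)) → XArc∈x-arcsInto a′ }

  module _ (acyclic : Acyclic A) (conservation : ∀ v → inDeg v ≡ outDeg v) where

    -- Recursion on the fuel k; since walks in an acyclic graph have fewer
    -- than |V̄| arcs, the fuel |V̄| never runs out.
    toSink-or-long : ∀ k {v} → 1 ≤ outDeg v →
                     XWalk (inn v) sink ⊎ Σ[ w ∈ Node n ] Σ[ p ∈ Walk A (inn v) w ] k ≤ length (arcsW p)
    toSink-or-long zero _ = inj₂ (_ , [] , z≤n)
    toSink-or-long (suc k) 1≤out with 1≤outDeg⇒XArc 1≤out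
    ... | source , () , _
    ... | sink , a = inj₁ (a ◅ []ˣ)
    ... | inn w , a with toSink-or-long k (subst (1 ≤_) (conservation w) (XArc⇒1≤inDeg a))
    ...   | inj₁ q = inj₁ (a ◅ q)
    ...   | inj₂ (_ , p , k≤p) = inj₂ (_ , proj₁ a ∷ p , s≤s k≤p)

    toSink : ∀ {v} → 1 ≤ outDeg v → XWalk (inn v) sink
    toSink 1≤out with toSink-or-long (length (allNodes n)) 1≤out
    ... | inj₁ q = q
    ... | inj₂ (_ , p , long) = contradiction long (ℕP.<⇒≱ (length-arcsW< acyclic p))

    fromSource-or-long : ∀ k {v} → 1 ≤ inDeg v →
                         XWalk source (inn v) ⊎ Σ[ u ∈ Node n ] Σ[ p ∈ Walk A u (inn v) ] k ≤ length (arcsW p)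
    fromSource-or-long zero _ = inj₂ (_ , [] , z≤n)
    fromSource-or-long (suc k) 1≤in with 1≤inDeg⇒XArc 1≤in
    ... | source , a = inj₁ (a ◅ []ˣ)
    ... | sink , () , _
    ... | inn u , a with fromSource-or-long k (subst (1 ≤_) (sym (conservation u)) (XArc⇒1≤outDeg a))
    ...   | inj₁ p = inj₁ (p ++ˣ (a ◅ []ˣ))
    ...   | inj₂ (_ , p , k≤p) =
      inj₂ (_ , p ++W (proj₁ a ∷ []) , subst (suc k ≤_) (sym (length-arcsW-▻ p (proj₁ a))) (s≤s k≤p))

    fromSource : ∀ {v} → 1 ≤ inDeg v → XWalk source (inn v)
    fromSource 1≤in with fromSource-or-long (length (allNodes n)) 1≤in
    ... | inj₁ p = p
    ... | inj₂ (_ , p , long) = contradiction long (ℕP.<⇒≱ (length-arcsW< acyclic p))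

  common-end⇒reachable : (∀ k → inDeg k ≤ 1) →
    ∀ {u u′ v} (p : Walk A u (inn v)) → All (λ a → T (x a)) (arcsW p) → XWalk u′ (inn v) →
    XWalk u u′ ⊎ XWalk u′ u
  common-end⇒reachable deg≤1 [] [] q = inj₂ q
  common-end⇒reachable deg≤1 (_∷_ {u} {v = source} e p) xp q = ⊥-elim (no-arc-into-source u e)
  common-end⇒reachable deg≤1 (_∷_ {v = sink} e (() ∷ p)) xp q
  common-end⇒reachable deg≤1 (_∷_ {v = inn k} e p) (xe ∷ xp) q with common-end⇒reachable deg≤1 p xp q
  ... | inj₁ r = inj₁ ((e , xe) ◅ r)
  ... | inj₂ r with unsnoc r
  ...   | inj₁ refl = inj₁ ((e , xe) ◅ []ˣ)
  ...   | inj₂ (s , r′ , a) with refl ← inDeg≤1⇒XArc-unique (deg≤1 k) a (e , xe) = inj₂ r′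

  exit-arc : (S : Subset n) → ∀ {u} (q : Walk A u sink) → All (λ a → T (x a)) (arcsW q) → T (inS S u) →
         Σ[ a ∈ Arc A ] (a ∈ arcsW q × T (outOfSet S a) × XWalk u (tl a))
  exit-arc S [] [] ()
  exit-arc S (_∷_ {v = v} e q) (xe ∷ xq) u∈S with inS S v in v∈S?
  ... | true with a , a∈q , a-out , r ← exit-arc S q xq (subst T (sym v∈S?) tt) =
    a , there a∈q , a-out , (e , xe) ◅ r
  ... | false = _ , here refl , Equivalence.from T-∧ (u∈S , subst (λ b → T (not b)) (sym v∈S?) tt) , []ˣ

module AdmissibleFlow {n : ℕ} (A Ǎ : Rel n) (x : Arc A → Bool) (admissible : Admissible A Ǎ x) where
  open Support A x

  inDeg≤1 : ∀ v → inDeg v ≤ 1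
  inDeg≤1 v = ℕtoℚ-cancel-≤ (subst (ℚ._≤ 1ℚ) (sumArcs≡count _) (proj₁ admissible v))

  conservation : ∀ v → inDeg v ≡ outDeg v
  conservation v = ℕtoℚ-injective (begin
    ℕtoℚ (inDeg v)                                ≡⟨ sumArcs≡count _ ⟨
    sumArcs A (inArc (inn v)) (λ a → b2q (x a))  ≡⟨ proj₁ (proj₂ admissible) v ⟩
    sumArcs A (outArc (inn v)) (λ a → b2q (x a)) ≡⟨ sumArcs≡count _ ⟩
    ℕtoℚ (outDeg v)                               ∎)
    where open ≡-Reasoning

  XWalk⇒feasible : (p : XWalk source sink) → Feasible Ǎ (proj₁ p)
  XWalk⇒feasible (p , xp) with any? (λ a → T? (InCheck Ǎ a)) (arcsW p)
  ... | yes feasible = feasible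
  ... | no infeasible = ⊥-elim (length≰pred p (ℕtoℚ-cancel-≤ (begin
    ℕtoℚ (length (arcsW p))                ≡⟨ cong ℕtoℚ (count-all x xp) ⟨
    ℕtoℚ (count x (arcsW p))               ≡⟨ sumQ-b2q≡count x (arcsW p) ⟨
    sumQ (map (λ a → b2q (x a)) (arcsW p)) ≤⟨ proj₂ (proj₂ admissible) p infeasible ⟩
    ℕtoℚ (length (arcsW p) ∸ 1)            ∎)))
    where
    open ℚP.≤-Reasoning
    length≰pred : (p : Walk A source sink) → ¬ length (arcsW p) ≤ length (arcsW p) ∸ 1
    length≰pred (e ∷ p) = ℕP.<-irrefl refl

module AdmissibleCut {n : ℕ} (A Ǎ : Rel n) (acyclic : Acyclic A) (S Tset : Subset n) (T⊆S : Tset ⊆ S)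
           (conflicting : ConflictingSet A Tset)
           (B : Arc A → Bool) (B⇔À⁺ : ∀ a → T (B a) ⇔ InAgraveT A Ǎ Tset a)
           (x : Arc A → Bool) (admissible : Admissible A Ǎ x) where
  open Graph A
  open Support A x
  open AdmissibleFlow A Ǎ x admissible

  Ts : List (Fin n)
  Ts = filter (λ i → T? (Tset i)) (allFin n)

  cut used-cut : List (Arc A)
  cut = filter (λ a → T? (outOfSet S a ∧ B a)) (allArcs A)
  used-cut = filter (λ a → T? (x a)) cut

  record ExitsVia (i : Fin n) (a : Arc A) : Set where
    constructor exitsVia
    field
      start∈T : T (Tset i)
      tail∈S : T (inS S (tl a))
      walk : XWalk (inn i) (tl a)

  ExitsVia-injective : ∀ {i j a} → ExitsVia i a → ExitsVia j a → i ≡ j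
  ExitsVia-injective {a = (source , _) , _} (exitsVia _ () _) _
  ExitsVia-injective {a = (sink , _) , _} (exitsVia _ () _) _
  ExitsVia-injective {i} {j} {(inn _ , _) , _} (exitsVia i∈T _ (p , xp)) (exitsVia j∈T _ q) with i Fin.≟ j
  ... | yes i≡j = i≡j
  ... | no i≢j with common-end⇒reachable inDeg≤1 p xp q
  ...   | inj₁ (r , _) = ⊥-elim (conflicting i j i∈T j∈T i≢j (_ , _ , r , ∈-nodesW-start r , ∈-nodesW-end r))
  ...   | inj₂ (r , _) = ⊥-elim (conflicting i j i∈T j∈T i≢j (_ , _ , r , ∈-nodesW-end r , ∈-nodesW-start r))

  exits-via-cut : ∀ {i} → T (Tset i) → 1 ≤ inDeg i → ∃[ a ] (a ∈ used-cut × ExitsVia i a)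
  exits-via-cut {i} i∈T 1≤in = leave-S (exit-arc S (proj₁ q) (proj₂ q) (T⊆S i i∈T))
    where
    p : XWalk source (inn i)
    p = fromSource acyclic conservation 1≤in
    q : XWalk (inn i) sink
    q = toSink acyclic conservation (subst (1 ≤_) (conservation i) 1≤in)
    leave-S : Σ[ a ∈ Arc A ] (a ∈ arcsW (proj₁ q) × T (outOfSet S a) × XWalk (inn i) (tl a)) →
              ∃[ a ] (a ∈ used-cut × ExitsVia i a)
    leave-S (a , a∈q , a-out , r) = a , a∈used-cut , exitsVia i∈T (proj₁ (Equivalence.to T-∧ a-out)) r
      where
      a∈À⁺ : InAgraveT A Ǎ Tset a
      a∈À⁺ = i , i∈T , proj₁ p , proj₁ q , XWalk⇒feasible (p ++ˣ q) , a∈q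
      a∈used-cut : a ∈ used-cut
      a∈used-cut = ∈-filter⁺ (λ a → T? (x a))
                (∈-filter⁺ (λ a → T? (outOfSet S a ∧ B a)) (allArcs-complete a)
                  (Equivalence.from T-∧ (a-out , Equivalence.from (B⇔À⁺ a) a∈À⁺)))
                (All.lookup (proj₂ q) a∈q)

  cut-count : sum (map inDeg Ts) ≤ count x cut
  cut-count = ℕP.≤-trans (sum≤length-filter inDeg inDeg≤1 Ts)
    (injection⇒length≤ ExitsVia (filter⁺ (λ i → 1 ≤? inDeg i) (filter⁺ (λ i → T? (Tset i)) (allFin⁺ n)))
      image ExitsVia-injective)
    where
    image : ∀ {i} → i ∈ filter (λ i → 1 ≤? inDeg i) Ts → ∃[ a ] (a ∈ used-cut × ExitsVia i a)
    image i∈ with i∈Ts , 1≤in ← ∈-filter⁻ (λ i → 1 ≤? inDeg i) {xs = Ts} i∈ =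
      exits-via-cut (proj₂ (∈-filter⁻ (λ i → T? (Tset i)) {xs = allFin n} i∈Ts)) 1≤in

  cut-inequality : sumV Tset (zval A (λ a → b2q (x a))) ℚ.≤
                   sumArcs A (λ a → outOfSet S a ∧ B a) (λ a → b2q (x a))
  cut-inequality = begin
    sumV Tset (zval A (λ a → b2q (x a)))                    ≡⟨ cong sumQ (map-cong (λ i → sumArcs≡count (inArc (inn i))) Ts) ⟩
    sumQ (map (λ i → ℕtoℚ (inDeg i)) Ts)                    ≡⟨ sumQ-map-ℕtoℚ inDeg Ts ⟩
    ℕtoℚ (sum (map inDeg Ts))                               ≤⟨ ℕtoℚ-mono-≤ cut-count ⟩
    ℕtoℚ (count x cut)                                      ≡⟨ sumArcs≡count (λ a → outOfSet S a ∧ B a) ⟨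
    sumArcs A (λ a → outOfSet S a ∧ B a) (λ a → b2q (x a)) ∎
    where open ℚP.≤-Reasoning

module _ {n : ℕ} (A : Rel n) (cs : List (ℚ × (Arc A → Bool))) {y : Arc A → ℚ}
         (y≡ : ∀ a → y a ≡ combine cs (λ x → b2q (x a))) where

  sumArcs-combine : ∀ P → sumArcs A P y ≡ combine cs (λ x → sumArcs A P (λ a → b2q (x a)))
  sumArcs-combine P = trans (cong sumQ (map-cong y≡ arcs)) (sumQ-map-combine cs (λ x a → b2q (x a)) arcs)
    where
    arcs : List (Arc A)
    arcs = filter (λ a → T? (P a)) (allArcs A)

  sumV-zval-combine : ∀ Tset → sumV Tset (zval A y) ≡ combine cs (λ x → sumV Tset (zval A (λ a → b2q (x a))))
  sumV-zval-combine Tset = trans (cong sumQ (map-cong (λ i → sumArcs-combine (inArc (inn i))) Ts))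
    (sumQ-map-combine cs (λ x → zval A (λ a → b2q (x a))) Ts)
    where
    Ts : List (Fin n)
    Ts = filter (λ i → T? (Tset i)) (allFin n)

proposition9 : (n : ℕ) (A Ǎ : Rel n) → (∀ i j → T (Ǎ i j) → T (A i j)) → Acyclic A →
    (S Tset : Subset n) → Tset ⊆ S → ConflictingSet A Tset →
    (B : Arc A → Bool) → (∀ a → T (B a) ⇔ InAgraveT A Ǎ Tset a) →
    (y : Arc A → ℚ) → InP A Ǎ y →
    sumArcs A (λ a → outOfSet S a ∧ B a) y ≥ sumV Tset (zval A y)
proposition9 n A Ǎ _ acyclic S Tset T⊆S conflicting B B⇔À⁺ y (cs , weighted-admissible , _ , y≡) = begin
  sumV Tset (zval A y)                                       ≡⟨ sumV-zval-combine A cs y≡ Tset ⟩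
  combine cs (λ x → sumV Tset (zval A (λ a → b2q (x a))))   ≤⟨ combine-mono cs weighted-admissible binary ⟩
  combine cs (λ x → sumArcs A δ⁺S∩À⁺ (λ a → b2q (x a)))     ≡⟨ sumArcs-combine A cs y≡ δ⁺S∩À⁺ ⟨
  sumArcs A δ⁺S∩À⁺ y                                         ∎
  where
  open ℚP.≤-Reasoning
  δ⁺S∩À⁺ : Arc A → Bool
  δ⁺S∩À⁺ a = outOfSet S a ∧ B a
  binary : ∀ x → Admissible A Ǎ x →
           sumV Tset (zval A (λ a → b2q (x a))) ℚ.≤ sumArcs A δ⁺S∩À⁺ (λ a → b2q (x a))
  binary x = AdmissibleCut.cut-inequality A Ǎ acyclic S Tset T⊆S conflicting B B⇔À⁺ x
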